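{- Let ${\cal D}$ be a balanced quadriculated disk, $p_0,p_1$ plugs, and ${\mathbf t}\in{\cal T}({\cal R}_{N_0,N_1;p_0,p_1})$. Let ${\mathbf t}_{\operatorname{vert},p_0}\in{\cal T}({\cal R}_{N_0-2,N_0;p_0,p_0})$ and ${\mathbf t}_{\operatorname{vert},p_1}\in{\cal T}({\cal R}_{N_1,N_1+2;p_1,p_1})$ be the tilings by vertical dominoes only. Let $\tilde{\mathbf t}_0$ be ${\mathbf t}_{\operatorname{vert},p_0}\ast{\mathbf t}\in{\cal T}({\cal R}_{N_0-2,N_1;p_0,p_1})$ translated by $(0,0,2)$, so $\tilde{\mathbf t}_0\in{\cal T}({\cal R}_{N_0,N_1+2;p_0,p_1})$, and let $\tilde{\mathbf t}_1={\mathbf t}\ast{\mathbf t}_{\operatorname{vert},p_1}\in{\cal T}({\cal R}_{N_0,N_1+2;p_0,p_1})$. Then $\tilde{\mathbf t}_0\approx\tilde{\mathbf t}_1$.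
   Context: A quadriculated disk ${\cal D}\subset\mathbb{R}^2$ is a finite union of unit squares $[a,a+1]\times[b,b+1]$, $(a,b)\in\mathbb{Z}^2$, contractible with contractible interior; squares have color $(-1)^{a+b}$; balanced means equally many squares of each color. A plug is a union $p\subseteq{\cal D}$ of unit squares of ${\cal D}$ with equally many of each color (possibly empty). For integers $N_1\ge N_0+2$ and plugs $p,\tilde p$, the cork is ${\cal R}_{N_0,N_1;p,\tilde p}=({\cal D}\times[N_0,N_1])\setminus\operatorname{int}((p\times[N_0,N_0+1])\cup(\tilde p\times[N_1-1,N_1]))$. A (3D) domino is a union of two unit cubes with integer vertices sharing a face; vertical if of the form $[a,a+1]\times[b,b+1]\times[c,c+2]$. ${\cal T}({\cal R})$ is the set of domino tilings of ${\cal R}$. Concatenation: for ${\mathbf t}_{01}\in{\cal T}({\cal R}_{N_0,N_1;p_0,p_1})$ and ${\mathbf t}_{12}\in{\cal T}({\cal R}_{N_1,N_2;p_1,p_2})$, ${\mathbf t}_{01}\ast{\mathbf t}_{12}\in{\cal T}({\cal R}_{N_0,N_2;p_0,p_2})$ consists of the dominoes of ${\mathbf t}_{01}$, those of ${\mathbf t}_{12}$, and the vertical dominoes $s\times[N_1-1,N_1+1]$ for the unit squares $s$ of $p_1$. A flip removes two dominoes whose union is a $2\times2\times1$ box and replaces them by the other pair tiling that box; $\approx$ means joined by finitely many flips. -}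

module Defs where

open import Data.Bool using (Bool; true; false)
open import Data.Nat as ℕ using (ℕ; _%_)
open import Data.Integer using (ℤ; +_; _+_; _-_; ∣_∣; _≤_; _<_)
open import Data.Product using (Σ; _×_; _,_)
open import Data.Sum using (_⊎_)
open import Data.Empty using (⊥)
open import Data.List using (List; []; _∷_)
open import Data.List.Membership.Propositional using (_∈_)
open import Data.List.Relation.Unary.All using (All)
open import Data.List.Relation.Unary.Unique.Propositional using (Unique)
open import Relation.Nullary using (¬_)
open import Relation.Binary.PropositionalEquality using (_≡_; _≢_)
open import Relation.Binary.Construct.Closure.ReflexiveTransitive using (Star)
open import Function.Bundles using (_⇔_)

-- A unit square [a,a+1]×[b,b+1] is represented by (a , b).
Sq : Set
Sq = ℤ × ℤ

-- true iff colour (-1)^(a+b) = +1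
colour : Sq → Bool
colour (a , b) = ∣ a + b ∣ % 2 ℕ.≡ᵇ 0

countCol : Bool → List Sq → ℕ
countCol c [] = 0
countCol true  (s ∷ ss) with colour s
... | true  = ℕ.suc (countCol true ss)
... | false = countCol true ss
countCol false (s ∷ ss) with colour s
... | true  = countCol false ss
... | false = ℕ.suc (countCol false ss)

Balanced : List Sq → Set
Balanced S = countCol true S ≡ countCol false S

Adj : Sq → Sq → Set
Adj (a , b) (a' , b') =
  (a' ≡ a + + 1 × b' ≡ b) ⊎ (a ≡ a' + + 1 × b' ≡ b) ⊎
  (a' ≡ a × b' ≡ b + + 1) ⊎ (a' ≡ a × b ≡ b' + + 1)

data Path (S : Sq → Set) : Sq → Sq → Set where
  here : ∀ {a} → S a → Path S a a
  step : ∀ {a b c} → S a → Adj a b → Path S b c → Path S a c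

Connected : (Sq → Set) → Set
Connected S = ∀ a b → S a → S b → Path S a b

-- A quadriculated disk: a finite nonempty set of unit squares (a duplicate-free
-- list) whose union is contractible with contractible interior.  For unions of
-- closed unit squares this is: the squares are edge-connected (interior
-- connected) and the complementary squares of ℤ² are edge-connected
-- (no holes, neither in the region nor in its interior).
IsDisk : List Sq → Set
IsDisk D = Unique D × (D ≢ []) × Connected (_∈ D) × Connected (λ s → ¬ (s ∈ D))

IsPlug : List Sq → List Sq → Set
IsPlug D p = Unique p × All (_∈ D) p × Balanced p

-- the unit cube [x,x+1]×[y,y+1]×[z,z+1] is represented by (x , y , z)
Cube : Set
Cube = ℤ × ℤ × ℤ

data Dir : Set where
  X Y Z : Dir

e : Dir → Cube
e X = (+ 1 , + 0 , + 0)
e Y = (+ 0 , + 1 , + 0)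
e Z = (+ 0 , + 0 , + 1)

_+ᶜ_ : Cube → Cube → Cube
(x , y , z) +ᶜ (x' , y' , z') = (x + x' , y + y' , z + z')

-- the domino (c , d) is the union of the cubes c and c + e d
Domino : Set
Domino = Cube × Dir

Covers : Domino → Cube → Set
Covers (c , d) c' = (c' ≡ c) ⊎ (c' ≡ c +ᶜ e d)

Region : Set₁
Region = Cube → Set

DSet : Set₁
DSet = Domino → Set

IsTiling : Region → DSet → Set
IsTiling R t =
  (∀ c d → t (c , d) → R c × R (c +ᶜ e d)) ×
  (∀ c → R c → Σ Domino λ δ → t δ × Covers δ c ×
                 (∀ δ' → t δ' → Covers δ' c → δ' ≡ δ))

Cork : List Sq → ℤ → ℤ → List Sq → List Sq → Region
Cork D N0 N1 p p̃ (x , y , z) =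
  ((x , y) ∈ D) × N0 ≤ z × z < N1 ×
  ¬ (((x , y) ∈ p) × z ≡ N0) × ¬ (((x , y) ∈ p̃) × z ≡ N1 - + 1)

vert : List Sq → List Sq → ℤ → DSet
vert D p N ((x , y , z) , d) = ((x , y) ∈ D) × ¬ ((x , y) ∈ p) × z ≡ N × d ≡ Z

concat : DSet → DSet → List Sq → ℤ → DSet
concat t01 t12 p1 N1 δ@((x , y , z) , d) =
  t01 δ ⊎ t12 δ ⊎ (((x , y) ∈ p1) × z ≡ N1 - + 1 × d ≡ Z)

shiftZ : ℤ → DSet → DSet
shiftZ k t ((x , y , z) , d) = t ((x , y , z - k) , d)

-- t' is obtained from t by a single flip in the 2×2×1 box spanned at the
-- cube b by the directions u ≠ v: the dominoes (b,u),(b+e v,u) are replaced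
-- by (b,v),(b+e u,v); all other dominoes are unchanged.  (Swapping u and v
-- gives the reverse flip.)
Flip : DSet → DSet → Set
Flip t t' = Σ Cube λ b → Σ Dir λ u → Σ Dir λ v →
  u ≢ v ×
  t (b , u) × t (b +ᶜ e v , u) × ¬ t' (b , u) × ¬ t' (b +ᶜ e v , u) ×
  t' (b , v) × t' (b +ᶜ e u , v) × ¬ t (b , v) × ¬ t (b +ᶜ e u , v) ×
  (∀ δ → δ ≢ (b , u) → δ ≢ (b +ᶜ e v , u) → δ ≢ (b , v) → δ ≢ (b +ᶜ e u , v) →
         t δ ⇔ t' δ)

-- t ≈ t' : joined by finitely many flips (up to extensional equality of
-- the sets of dominoes)
_≈_ : DSet → DSet → Set₁
t ≈ t' = Σ DSet λ s → Star Flip t s × (∀ δ → s δ ⇔ t' δ)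

-- Sweep a layer of vertical dominoes, one per column of D, upward through t.  At stage (k , L)
-- the dominoes of t based below height k, or at height k in a column of L, stay in place, the
-- others are raised by 2, and each column s carries a vertical domino at height F s filling the
-- gap between the two.  At the start (k = N₀, the gap at N₀, or at N₀ + 1 above a cell of p₀)
-- this is t̃₀, and at the end (k = N₁) it is t̃₁.  Passing a vertical domino of t only relabels
-- dominoes; passing a horizontal one costs two flips.

module Submission where

open import Defs
open import Level using (0ℓ)
open import Data.Nat using (ℕ; zero; suc)
open import Data.Integer using (ℤ; +_; _+_; _-_; -_; ∣_∣; _≤_; _<_)
import Data.Integer.Properties as ℤ
open import Data.Integer.Solver using (module +-*-Solver)
open +-*-Solver using (solve; _:+_; _:-_; con; _:=_)
open import Data.Product using (Σ; _×_; _,_; proj₁; proj₂)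
open import Data.Product.Properties using (≡-dec)
open import Data.Sum using (_⊎_; inj₁; inj₂)
open import Data.Empty using (⊥-elim)
open import Data.List using (List; []; _∷_)
open import Data.List.Membership.Propositional using (_∈_)
open import Data.List.Relation.Binary.Subset.Propositional using (_⊆_)
open import Data.List.Relation.Unary.Any using (here; there)
open import Data.List.Relation.Unary.All using (All; lookup)
open import Relation.Nullary using (¬_; Dec; yes; no)
open import Relation.Nullary.Decidable using (_×-dec_; ¬?)
open import Relation.Binary.PropositionalEquality
open import Relation.Binary.Definitions using (tri<; tri≈; tri>; DecidableEquality)
open import Relation.Binary.Structures using (IsEquivalence)
open import Relation.Binary.Construct.Closure.ReflexiveTransitive using (Star; ε; _◅_; _◅◅_)
open import Function.Bundles using (_⇔_; mk⇔; Equivalence)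
open import Function.Properties.Equivalence using (⇔-isEquivalence)

open Equivalence using (to; from)
private module ⇔ = IsEquivalence (⇔-isEquivalence {ℓ = 0ℓ})

infix 4 _≐_

_≐_ : DSet → DSet → Set
s ≐ s' = ∀ δ → s δ ⇔ s' δ

≐-refl : ∀ {s} → s ≐ s
≐-refl δ = ⇔.refl

≐-trans : ∀ {s s' s''} → s ≐ s' → s' ≐ s'' → s ≐ s''
≐-trans s≐s' s'≐s'' δ = ⇔.trans (s≐s' δ) (s'≐s'' δ)

≐⇒≈ : ∀ {s s'} → s ≐ s' → s ≈ s'
≐⇒≈ {s} s≐s' = s , ε , s≐s'

Flip⇒≈ : ∀ {s s'} → Flip s s' → s ≈ s'
Flip⇒≈ {s' = s'} f = s' , f ◅ ε , ≐-refl

Flip-respˡ-≐ : ∀ {s s' s''} → s' ≐ s → Flip s s'' → Flip s' s''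
Flip-respˡ-≐ s'≐s (b , u , v , u≢v , s₁ , s₂ , ¬s''₁ , ¬s''₂ , s''₁ , s''₂ , ¬s₃ , ¬s₄ , rest) =
  b , u , v , u≢v , from (s'≐s _) s₁ , from (s'≐s _) s₂ , ¬s''₁ , ¬s''₂ , s''₁ , s''₂ ,
  (λ x → ¬s₃ (to (s'≐s _) x)) , (λ x → ¬s₄ (to (s'≐s _) x)) ,
  (λ δ n₁ n₂ n₃ n₄ → ⇔.trans (s'≐s δ) (rest δ n₁ n₂ n₃ n₄))

Flips-respˡ-≐ : ∀ {s s' s''} → s' ≐ s → Star Flip s s'' →
                Σ DSet λ r → Star Flip s' r × r ≐ s''
Flips-respˡ-≐ {s' = s'} s'≐s ε = s' , ε , s'≐s
Flips-respˡ-≐ {s'' = s''} s'≐s (f ◅ fs) = s'' , Flip-respˡ-≐ s'≐s f ◅ fs , ≐-refl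

≈-trans : ∀ {s s' s''} → s ≈ s' → s' ≈ s'' → s ≈ s''
≈-trans (r₁ , fs₁ , r₁≐s') (r₂ , fs₂ , r₂≐s'') with Flips-respˡ-≐ r₁≐s' fs₂
... | r , fs , r≐r₂ = r , fs₁ ◅◅ fs , ≐-trans r≐r₂ r₂≐s''

exchange : DSet → Domino → Domino → Domino → Domino → DSet
exchange s α₁ α₂ β₁ β₂ δ = (s δ × δ ≢ α₁ × δ ≢ α₂) ⊎ δ ≡ β₁ ⊎ δ ≡ β₂

flip-exchange : ∀ (s : DSet) (b : Cube) (u v : Dir) → u ≢ v →
  s (b , u) → s (b +ᶜ e v , u) → ¬ s (b , v) → ¬ s (b +ᶜ e u , v) →
  Flip s (exchange s (b , u) (b +ᶜ e v , u) (b , v) (b +ᶜ e u , v))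
flip-exchange s b u v u≢v s₁ s₂ ¬s₃ ¬s₄ =
  b , u , v , u≢v , s₁ , s₂ , removed₁ , removed₂ , inj₂ (inj₁ refl) , inj₂ (inj₂ refl) , ¬s₃ , ¬s₄ , rest
  where
  s' : DSet
  s' = exchange s (b , u) (b +ᶜ e v , u) (b , v) (b +ᶜ e u , v)
  removed₁ : ¬ s' (b , u)
  removed₁ (inj₁ (_ , ne , _)) = ne refl
  removed₁ (inj₂ (inj₁ eq)) = u≢v (cong proj₂ eq)
  removed₁ (inj₂ (inj₂ eq)) = u≢v (cong proj₂ eq)
  removed₂ : ¬ s' (b +ᶜ e v , u)
  removed₂ (inj₁ (_ , _ , ne)) = ne refl
  removed₂ (inj₂ (inj₁ eq)) = u≢v (cong proj₂ eq)
  removed₂ (inj₂ (inj₂ eq)) = u≢v (cong proj₂ eq)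
  rest : ∀ δ → δ ≢ (b , u) → δ ≢ (b +ᶜ e v , u) → δ ≢ (b , v) → δ ≢ (b +ᶜ e u , v) → s δ ⇔ s' δ
  rest δ n₁ n₂ n₃ n₄ = mk⇔ (λ x → inj₁ (x , n₁ , n₂)) back
    where
    back : s' δ → s δ
    back (inj₁ (x , _ , _)) = x
    back (inj₂ (inj₁ eq)) = ⊥-elim (n₃ eq)
    back (inj₂ (inj₂ eq)) = ⊥-elim (n₄ eq)

i+1≤j⇒i<j : ∀ {i j} → i + + 1 ≤ j → i < j
i+1≤j⇒i<j {i} h = ℤ.suc[i]≤j⇒i<j (subst (_≤ _) (ℤ.+-comm i (+ 1)) h)

i<j⇒i+1≤j : ∀ {i j} → i < j → i + + 1 ≤ j
i<j⇒i+1≤j {i} h = subst (_≤ _) (ℤ.+-comm (+ 1) i) (ℤ.i<j⇒suc[i]≤j h)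

i≮i : ∀ {i} → ¬ i < i
i≮i = ℤ.<-irrefl refl

i+1-1≡i : ∀ i → i + + 1 - + 1 ≡ i
i+1-1≡i = solve 1 (λ x → x :+ con (+ 1) :- con (+ 1) := x) refl

i-1+1≡i : ∀ i → i - + 1 + + 1 ≡ i
i-1+1≡i = solve 1 (λ x → x :- con (+ 1) :+ con (+ 1) := x) refl

i-2+1≡i-1 : ∀ i → i - + 2 + + 1 ≡ i - + 1
i-2+1≡i-1 = solve 1 (λ x → x :- con (+ 2) :+ con (+ 1) := x :- con (+ 1)) refl

i-2+1+1≡i : ∀ i → i - + 2 + + 1 + + 1 ≡ i
i-2+1+1≡i = solve 1 (λ x → x :- con (+ 2) :+ con (+ 1) :+ con (+ 1) := x) refl

i+2-2≡i : ∀ i → i + + 2 - + 2 ≡ i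
i+2-2≡i = solve 1 (λ x → x :+ con (+ 2) :- con (+ 2) := x) refl

i+2-1≡i+1 : ∀ i → i + + 2 - + 1 ≡ i + + 1
i+2-1≡i+1 = solve 1 (λ x → x :+ con (+ 2) :- con (+ 1) := x :+ con (+ 1)) refl

i+1-2≡i-1 : ∀ i → i + + 1 - + 2 ≡ i - + 1
i+1-2≡i-1 = solve 1 (λ x → x :+ con (+ 1) :- con (+ 2) := x :- con (+ 1)) refl

i+1+1-2≡i : ∀ i → i + + 1 + + 1 - + 2 ≡ i
i+1+1-2≡i = solve 1 (λ x → x :+ con (+ 1) :+ con (+ 1) :- con (+ 2) := x) refl

i+1+1≡i+2 : ∀ i → i + + 1 + + 1 ≡ i + + 2
i+1+1≡i+2 = solve 1 (λ x → x :+ con (+ 1) :+ con (+ 1) := x :+ con (+ 2)) refl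

i-2+2≡i : ∀ i → i - + 2 + + 2 ≡ i
i-2+2≡i = solve 1 (λ x → x :- con (+ 2) :+ con (+ 2) := x) refl

i-1+2≡i+1 : ∀ i → i - + 1 + + 2 ≡ i + + 1
i-1+2≡i+1 = solve 1 (λ x → x :- con (+ 1) :+ con (+ 2) := x :+ con (+ 1)) refl

i+[j-i]≡j : ∀ i j → i + (j - i) ≡ j
i+[j-i]≡j = solve 2 (λ x y → x :+ (y :- x) := y) refl

i+0+0≡i : ∀ i → i + + 0 + + 0 ≡ i
i+0+0≡i i = trans (ℤ.+-identityʳ (i + + 0)) (ℤ.+-identityʳ i)

+1-injective : ∀ {i j} → i + + 1 ≡ j + + 1 → i ≡ j
+1-injective {i} {j} h = trans (sym (i+1-1≡i i)) (trans (cong (_- + 1) h) (i+1-1≡i j))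

i<i+1 : ∀ i → i < i + + 1
i<i+1 i = i+1≤j⇒i<j ℤ.≤-refl

i<i+2 : ∀ i → i < i + + 2
i<i+2 i = subst (i <_) (i+1+1≡i+2 i) (ℤ.<-trans (i<i+1 i) (i<i+1 (i + + 1)))

i+1<i+2 : ∀ i → i + + 1 < i + + 2
i+1<i+2 i = subst ((i + + 1) <_) (i+1+1≡i+2 i) (i<i+1 (i + + 1))

i-1<i : ∀ i → i - + 1 < i
i-1<i i = subst ((i - + 1) <_) (i-1+1≡i i) (i<i+1 (i - + 1))

i-2<i : ∀ i → i - + 2 < i
i-2<i i = ℤ.<-trans (subst ((i - + 2) <_) (i-2+1≡i-1 i) (i<i+1 (i - + 2))) (i-1<i i)

i≢i+1 : ∀ i → i ≢ i + + 1
i≢i+1 i = ℤ.<⇒≢ (i<i+1 i)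

i<j⇒i≤j-1 : ∀ {i j} → i < j → i ≤ j - + 1
i<j⇒i≤j-1 {i} h = subst (_≤ _) (i+1-1≡i i) (ℤ.+-monoˡ-≤ (- + 1) (i<j⇒i+1≤j h))

i≤j≤i+1⇒j≡i⊎j≡i+1 : ∀ {i j} → i ≤ j → j ≤ i + + 1 → j ≡ i ⊎ j ≡ i + + 1
i≤j≤i+1⇒j≡i⊎j≡i+1 {i} {j} i≤j j≤i+1 with j ℤ.≟ i
... | yes j≡i = inj₁ j≡i
... | no j≢i = inj₂ (ℤ.≤-antisym j≤i+1 (i<j⇒i+1≤j (ℤ.≤∧≢⇒< i≤j (λ i≡j → j≢i (sym i≡j)))))

i<j+1⇒i<j⊎i≡j : ∀ {i j} → i < j + + 1 → i < j ⊎ i ≡ j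
i<j+1⇒i<j⊎i≡j {i} {j} h with i ℤ.≟ j
... | yes i≡j = inj₂ i≡j
... | no i≢j = inj₁ (ℤ.≤∧≢⇒< (subst (i ≤_) (i+1-1≡i j) (i<j⇒i≤j-1 h)) i≢j)

_≟ˢ_ : DecidableEquality Sq
_≟ˢ_ = ≡-dec ℤ._≟_ ℤ._≟_

_≟ᶜ_ : DecidableEquality Cube
_≟ᶜ_ = ≡-dec ℤ._≟_ (≡-dec ℤ._≟_ ℤ._≟_)

open import Data.List.Membership.DecPropositional _≟ˢ_ using (_∈?_)

ex ey ez : Dir → ℤ
ex d = proj₁ (e d)
ey d = proj₁ (proj₂ (e d))
ez d = proj₂ (proj₂ (e d))

ez-horizontal : ∀ {u} → u ≢ Z → ez u ≡ + 0
ez-horizontal {X} _ = refl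
ez-horizontal {Y} _ = refl
ez-horizontal {Z} u≢Z = ⊥-elim (u≢Z refl)

cube-injective : ∀ {x y z x' y' z'} → _≡_ {A = Cube} (x , y , z) (x' , y' , z') →
                 x ≡ x' × y ≡ y' × z ≡ z'
cube-injective refl = refl , refl , refl

domino-injective : ∀ {x y z d x' y' z' d'} →
                   _≡_ {A = Domino} ((x , y , z) , d) ((x' , y' , z') , d') →
                   x ≡ x' × y ≡ y' × z ≡ z' × d ≡ d'
domino-injective refl = refl , refl , refl , refl

cube-≡ : ∀ {x y z x' y' z'} → x ≡ x' → y ≡ y' → z ≡ z' → _≡_ {A = Cube} (x , y , z) (x' , y' , z')
cube-≡ refl refl refl = refl

domino-≡ : ∀ {x y z d x' y' z' d'} → x ≡ x' → y ≡ y' → z ≡ z' → d ≡ d' →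
           _≡_ {A = Domino} ((x , y , z) , d) ((x' , y' , z') , d')
domino-≡ refl refl refl refl = refl

height-≢ : ∀ {x y z d x' y' z' d'} → z ≢ z' → _≢_ {A = Domino} ((x , y , z) , d) ((x' , y' , z') , d')
height-≢ z≢z' eq = z≢z' (proj₁ (proj₂ (proj₂ (domino-injective eq))))

neighbour-≢ : ∀ a₁ a₂ {u} → u ≢ Z → _≢_ {A = Sq} (a₁ , a₂) (a₁ + ex u , a₂ + ey u)
neighbour-≢ a₁ a₂ {X} _ eq = i≢i+1 a₁ (cong proj₁ eq)
neighbour-≢ a₁ a₂ {Y} _ eq = i≢i+1 a₂ (cong proj₂ eq)
neighbour-≢ a₁ a₂ {Z} u≢Z _ = u≢Z refl

covers-height : ∀ x y z d {x' y' z'} → Covers ((x , y , z) , d) (x' , y' , z') →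
  z' ≡ z ⊎ (d ≡ Z × z' ≡ z + + 1 × x' ≡ x × y' ≡ y)
covers-height x y z d (inj₁ eq) = inj₁ (proj₂ (proj₂ (cube-injective eq)))
covers-height x y z X (inj₂ eq) = inj₁ (trans (proj₂ (proj₂ (cube-injective eq))) (ℤ.+-identityʳ _))
covers-height x y z Y (inj₂ eq) = inj₁ (trans (proj₂ (proj₂ (cube-injective eq))) (ℤ.+-identityʳ _))
covers-height x y z Z (inj₂ eq) with cube-injective eq
... | x'≡ , y'≡ , z'≡ = inj₂ (refl , z'≡ , trans x'≡ (ℤ.+-identityʳ _) , trans y'≡ (ℤ.+-identityʳ _))

update : (Sq → ℤ) → Sq → ℤ → Sq → ℤ
update F s₀ v s with s ≟ˢ s₀
... | yes _ = v
... | no _ = F s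

update-same : ∀ F s v → update F s v s ≡ v
update-same F s v with s ≟ˢ s
... | yes _ = refl
... | no s≢s = ⊥-elim (s≢s refl)

update-other : ∀ F s₀ v s → s ≢ s₀ → update F s₀ v s ≡ F s
update-other F s₀ v s s≢s₀ with s ≟ˢ s₀
... | yes s≡s₀ = ⊥-elim (s≢s₀ s≡s₀)
... | no _ = refl

module Sweep (D p₀ p₁ : List Sq) (p₀⊆D : All (_∈ D) p₀) (p₁⊆D : All (_∈ D) p₁)
             (N₀ N₁ : ℤ) (N₀+2≤N₁ : N₀ + + 2 ≤ N₁)
             (t : DSet) (T : IsTiling (Cork D N₀ N₁ p₀ p₁) t) where

  R : Region
  R = Cork D N₀ N₁ p₀ p₁

  covered⇒∈R : ∀ {δ c} → t δ → Covers δ c → R c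
  covered⇒∈R {c , d} tδ (inj₁ refl) = proj₁ (proj₁ T c d tδ)
  covered⇒∈R {c , d} tδ (inj₂ refl) = proj₂ (proj₁ T c d tδ)

  covers-unique : ∀ {δ δ' c} → t δ → t δ' → Covers δ c → Covers δ' c → δ ≡ δ'
  covers-unique {δ} {δ'} {c} tδ tδ' cv cv' with proj₂ T c (covered⇒∈R tδ cv)
  ... | _ , _ , _ , unique = trans (unique δ tδ cv) (sym (unique δ' tδ' cv'))

  base∈R : ∀ {δ} → t δ → R (proj₁ δ)
  base∈R tδ = covered⇒∈R tδ (inj₁ refl)

  same-base⇒≡ : ∀ {δ δ'} → t δ → t δ' → proj₁ δ ≡ proj₁ δ' → δ ≡ δ'
  same-base⇒≡ tδ tδ' eq = covers-unique tδ tδ' (inj₁ refl) (inj₁ eq)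

  R? : (c : Cube) → Dec (R c)
  R? (x , y , z) = ((x , y) ∈? D) ×-dec ((N₀ ℤ.≤? z) ×-dec ((z ℤ.<? N₁) ×-dec
     (¬? (((x , y) ∈? p₀) ×-dec (z ℤ.≟ N₀)) ×-dec ¬? (((x , y) ∈? p₁) ×-dec (z ℤ.≟ N₁ - + 1)))))

  Processed : ℤ → List Sq → DSet
  Processed k L ((x , y , z) , _) = z < k ⊎ (z ≡ k × (x , y) ∈ L)

  Sweep : ℤ → List Sq → (Sq → ℤ) → DSet
  Sweep k L F ((x , y , z) , d) =
    (t ((x , y , z) , d) × Processed k L ((x , y , z) , d)) ⊎
    (t ((x , y , z - + 2) , d) × ¬ Processed k L ((x , y , z - + 2) , d)) ⊎
    (d ≡ Z × (x , y) ∈ D × z ≡ F (x , y))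

  -- The gap invariant: a vertical domino at height F s fits between the processed dominoes of
  -- column s and its raised unprocessed ones.
  Below : ℤ → List Sq → Sq → ℤ → Set
  Below k L (x , y) j = j < N₀ ⊎ ((x , y) ∈ p₀ × j ≡ N₀) ⊎
    Σ Domino λ δ → t δ × Processed k L δ × Covers δ (x , y , j)

  Above : ℤ → List Sq → Sq → ℤ → Set
  Above k L (x , y) j = N₁ ≤ j ⊎ ((x , y) ∈ p₁ × j ≡ N₁ - + 1) ⊎
    Σ Domino λ δ → t δ × ¬ Processed k L δ × Covers δ (x , y , j)

  GapAt : ℤ → List Sq → Sq → ℤ → Set
  GapAt k L s j = Below k L s (j - + 1) × Above k L s j

  Gap : ℤ → List Sq → (Sq → ℤ) → Set
  Gap k L F = ∀ s → s ∈ D → GapAt k L s (F s)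

  Processed-∷ : ∀ {k L s} δ → Processed k L δ → Processed k (s ∷ L) δ
  Processed-∷ _ (inj₁ z<k) = inj₁ z<k
  Processed-∷ _ (inj₂ (z≡k , m)) = inj₂ (z≡k , there m)

  Processed⇒≤ : ∀ {k L} x y z d → Processed k L ((x , y , z) , d) → z ≤ k
  Processed⇒≤ x y z d (inj₁ z<k) = ℤ.<⇒≤ z<k
  Processed⇒≤ x y z d (inj₂ (refl , _)) = ℤ.≤-refl

  ¬Processed⇒≥ : ∀ {k L} x y z d → ¬ Processed k L ((x , y , z) , d) → k ≤ z
  ¬Processed⇒≥ x y z d ¬p = ℤ.≮⇒≥ (λ z<k → ¬p (inj₁ z<k))

  >⇒¬Processed : ∀ {k L} x y z d → k < z → ¬ Processed k L ((x , y , z) , d)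
  >⇒¬Processed x y z d k<z (inj₁ z<k) = i≮i (ℤ.<-trans k<z z<k)
  >⇒¬Processed {k} x y z d k<z (inj₂ (z≡k , _)) = i≮i (subst (k <_) z≡k k<z)

  ∉⇒¬Processed : ∀ {k L a₁ a₂} d → ¬ (a₁ , a₂) ∈ L → ¬ Processed k L ((a₁ , a₂ , k) , d)
  ∉⇒¬Processed d s∉L (inj₁ k<k) = i≮i k<k
  ∉⇒¬Processed d s∉L (inj₂ (_ , s∈L)) = s∉L s∈L

  ProcessedAgree : ℤ → List Sq → ℤ → List Sq → Set
  ProcessedAgree k L k' L' = ∀ δ → t δ → Processed k L δ ⇔ Processed k' L' δ

  Sweep-cong : ∀ {k L k' L'} F → ProcessedAgree k L k' L' → Sweep k L F ≐ Sweep k' L' F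
  Sweep-cong F agree ((x , y , z) , d) = mk⇔
    (λ { (inj₁ (tδ , p)) → inj₁ (tδ , to (agree _ tδ) p)
       ; (inj₂ (inj₁ (tδ , ¬p))) → inj₂ (inj₁ (tδ , λ p → ¬p (from (agree _ tδ) p)))
       ; (inj₂ (inj₂ v)) → inj₂ (inj₂ v) })
    (λ { (inj₁ (tδ , p)) → inj₁ (tδ , from (agree _ tδ) p)
       ; (inj₂ (inj₁ (tδ , ¬p))) → inj₂ (inj₁ (tδ , λ p → ¬p (to (agree _ tδ) p)))
       ; (inj₂ (inj₂ v)) → inj₂ (inj₂ v) })

  Gap-cong : ∀ {k L k' L'} F → ProcessedAgree k L k' L' → Gap k L F → Gap k' L' F
  Gap-cong F agree gap s s∈D with gap s s∈D
  ... | below , above = below' below , above' above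
    where
    below' : ∀ {j} → Below _ _ s j → Below _ _ s j
    below' (inj₁ j<N₀) = inj₁ j<N₀
    below' (inj₂ (inj₁ hole)) = inj₂ (inj₁ hole)
    below' (inj₂ (inj₂ (δ , tδ , p , cv))) = inj₂ (inj₂ (δ , tδ , to (agree δ tδ) p , cv))
    above' : ∀ {j} → Above _ _ s j → Above _ _ s j
    above' (inj₁ N₁≤j) = inj₁ N₁≤j
    above' (inj₂ (inj₁ hole)) = inj₂ (inj₁ hole)
    above' (inj₂ (inj₂ (δ , tδ , ¬p , cv))) = inj₂ (inj₂ (δ , tδ , (λ p → ¬p (from (agree δ tδ) p)) , cv))

  gap-height : ∀ {k L F a₁ a₂} δ → t δ → ¬ Processed k L δ → Covers δ (a₁ , a₂ , k) →
               Gap k L F → (a₁ , a₂) ∈ D → F (a₁ , a₂) ≡ k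
  gap-height {k} {L} {F} {a₁} {a₂} δ tδ ¬p cv gap s∈D
    with gap (a₁ , a₂) s∈D | covered⇒∈R tδ cv | ℤ.<-cmp (F (a₁ , a₂)) k
  ... | _ , above | _ , _ , k<N₁ , _ , _ | tri< F<k _ _ = ⊥-elim (too-low above)
    where
    too-low : ¬ Above k L (a₁ , a₂) (F (a₁ , a₂))
    too-low (inj₁ N₁≤F) = ℤ.≤⇒≯ N₁≤F (ℤ.<-trans F<k k<N₁)
    too-low (inj₂ (inj₁ (_ , F≡N₁-1))) = ℤ.≤⇒≯ (i<j⇒i≤j-1 k<N₁) (subst (_< k) F≡N₁-1 F<k)
    too-low (inj₂ (inj₂ (((x , y , z) , d) , tδ' , ¬p' , cv'))) with covers-height x y z d cv'
    ... | inj₁ F≡z = ℤ.≤⇒≯ (¬Processed⇒≥ x y z d ¬p') (subst (_< k) F≡z F<k)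
    ... | inj₂ (_ , F≡z+1 , _ , _) =
          ℤ.≤⇒≯ (ℤ.≤-trans (¬Processed⇒≥ x y z d ¬p') (ℤ.<⇒≤ (i<i+1 z))) (subst (_< k) F≡z+1 F<k)
  ... | _ , _ | _ | tri≈ _ F≡k _ = F≡k
  ... | below , _ | _ , N₀≤k , _ , ¬hole₀ , _ | tri> _ _ k<F = ⊥-elim (too-high below)
    where
    k≤F-1 : k ≤ F (a₁ , a₂) - + 1
    k≤F-1 = i<j⇒i≤j-1 k<F
    ¬processed-cover : ∀ δ' → t δ' → Processed k L δ' → ¬ Covers δ' (a₁ , a₂ , k)
    ¬processed-cover δ' tδ' p cv' = ¬p (subst (Processed k L) (covers-unique tδ' tδ cv' cv) p)
    too-high : ¬ Below k L (a₁ , a₂) (F (a₁ , a₂) - + 1)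
    too-high (inj₁ F-1<N₀) = ℤ.≤⇒≯ (ℤ.≤-trans N₀≤k k≤F-1) F-1<N₀
    too-high (inj₂ (inj₁ (s∈p₀ , F-1≡N₀))) = ¬hole₀ (s∈p₀ , ℤ.≤-antisym (subst (k ≤_) F-1≡N₀ k≤F-1) N₀≤k)
    too-high (inj₂ (inj₂ (((x , y , z) , d) , tδ' , p , cv'))) with covers-height x y z d cv'
    ... | inj₁ F-1≡z = ¬processed-cover _ tδ' p (subst (λ w → Covers ((x , y , z) , d) (a₁ , a₂ , w))
                         (ℤ.≤-antisym (subst (_≤ k) (sym F-1≡z) (Processed⇒≤ x y z d p)) k≤F-1) cv')
    ... | inj₂ (_ , F-1≡z+1 , x≡ , y≡)
      with i≤j≤i+1⇒j≡i⊎j≡i+1 (Processed⇒≤ x y z d p) (subst (k ≤_) F-1≡z+1 k≤F-1)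
    ...   | inj₁ k≡z = ¬processed-cover _ tδ' p (inj₁ (cube-≡ x≡ y≡ k≡z))
    ...   | inj₂ k≡z+1 = ¬processed-cover _ tδ' p (subst (λ w → Covers ((x , y , z) , d) (a₁ , a₂ , w))
                           (trans F-1≡z+1 (sym k≡z+1)) cv')

  Above-intro : ∀ {k L} a₁ a₂ j → (a₁ , a₂) ∈ D → N₀ ≤ j → ¬ ((a₁ , a₂) ∈ p₀ × j ≡ N₀) →
                (∀ δ → t δ → Covers δ (a₁ , a₂ , j) → ¬ Processed k L δ) → Above k L (a₁ , a₂) j
  Above-intro a₁ a₂ j s∈D N₀≤j ¬hole₀ unprocessed with N₁ ℤ.≤? j
  ... | yes N₁≤j = inj₁ N₁≤j
  ... | no N₁≰j with ((a₁ , a₂) ∈? p₁) ×-dec (j ℤ.≟ N₁ - + 1)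
  ...   | yes hole₁ = inj₂ (inj₁ hole₁)
  ...   | no ¬hole₁ with proj₂ T (a₁ , a₂ , j) (s∈D , N₀≤j , ℤ.≰⇒> N₁≰j , ¬hole₀ , ¬hole₁)
  ...     | δ , tδ , cv , _ = inj₂ (inj₂ (δ , tδ , unprocessed δ tδ cv , cv))

  unprocessed-over-horizontal : ∀ {k L a₁ a₂} h → t h → proj₂ h ≢ Z → Covers h (a₁ , a₂ , k) →
                                ∀ δ → t δ → Covers δ (a₁ , a₂ , k + + 1) → ¬ Processed k L δ
  unprocessed-over-horizontal {k} h th h≢Z cvh ((x , y , z) , d) tδ cv p with covers-height x y z d cv
  ... | inj₁ k+1≡z = ℤ.≤⇒≯ (Processed⇒≤ x y z d p) (subst (k <_) k+1≡z (i<i+1 k))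
  ... | inj₂ (refl , k+1≡z+1 , refl , refl) =
        h≢Z (cong proj₂ (covers-unique th tδ cvh (inj₁ (cube-≡ refl refl (+1-injective k+1≡z+1)))))

  unprocessed-two-above : ∀ {k L a₁ a₂} δ → t δ → Covers δ (a₁ , a₂ , k + + 2) → ¬ Processed k L δ
  unprocessed-two-above {k} ((x , y , z) , d) tδ cv p with covers-height x y z d cv
  ... | inj₁ k+2≡z = ℤ.≤⇒≯ (Processed⇒≤ x y z d p) (subst (k <_) k+2≡z (i<i+2 k))
  ... | inj₂ (_ , k+2≡z+1 , _ , _) =
        ℤ.≤⇒≯ (Processed⇒≤ x y z d p)
              (subst (k <_) (+1-injective (trans (i+1+1≡i+2 k) k+2≡z+1)) (i<i+1 k))

  newly-processed : ∀ {k L a₁ a₂} h → t h → proj₁ h ≡ (a₁ , a₂ , k) →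
                    ∀ δ → t δ → Processed k ((a₁ , a₂) ∷ L) δ → ¬ Processed k L δ → δ ≡ h
  newly-processed h th base-h ((x , y , z) , d) tδ (inj₁ z<k) ¬p = ⊥-elim (¬p (inj₁ z<k))
  newly-processed h th base-h ((x , y , z) , d) tδ (inj₂ (z≡k , there m)) ¬p = ⊥-elim (¬p (inj₂ (z≡k , m)))
  newly-processed h th base-h ((x , y , z) , d) tδ (inj₂ (z≡k , here xy≡)) ¬p =
    same-base⇒≡ tδ th (trans (cube-≡ (cong proj₁ xy≡) (cong proj₂ xy≡) z≡k) (sym base-h))

  Below-∷ : ∀ {k L s' s j} → Below k L s j → Below k (s' ∷ L) s j
  Below-∷ (inj₁ j<N₀) = inj₁ j<N₀
  Below-∷ (inj₂ (inj₁ hole)) = inj₂ (inj₁ hole)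
  Below-∷ (inj₂ (inj₂ (δ , tδ , p , cv))) = inj₂ (inj₂ (δ , tδ , Processed-∷ δ p , cv))

  Above-∷ : ∀ {k L a₁ a₂ s j} h → t h → proj₁ h ≡ (a₁ , a₂ , k) → ¬ Covers h (proj₁ s , proj₂ s , j) →
            Above k L s j → Above k ((a₁ , a₂) ∷ L) s j
  Above-∷ h th base-h ¬cv (inj₁ N₁≤j) = inj₁ N₁≤j
  Above-∷ h th base-h ¬cv (inj₂ (inj₁ hole)) = inj₂ (inj₁ hole)
  Above-∷ h th base-h ¬cv (inj₂ (inj₂ (δ , tδ , ¬p , cv))) =
    inj₂ (inj₂ (δ , tδ , (λ p → ¬cv (subst (λ w → Covers w _) (newly-processed h th base-h δ tδ p ¬p) cv)) , cv))

  GapAt-∷ : ∀ {k L a₁ a₂ s j} h → t h → proj₁ h ≡ (a₁ , a₂ , k) → ¬ Covers h (proj₁ s , proj₂ s , j) →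
            GapAt k L s j → GapAt k ((a₁ , a₂) ∷ L) s j
  GapAt-∷ h th base-h ¬cv (below , above) = Below-∷ below , Above-∷ h th base-h ¬cv above

  module HorizontalMove (a₁ a₂ k : ℤ) (u : Dir) (u≢Z : u ≢ Z) (L : List Sq) (F : Sq → ℤ)
                        (th : t ((a₁ , a₂ , k) , u)) (A∉L : ¬ (a₁ , a₂) ∈ L) (gap : Gap k L F) where
    A B : Sq
    A = a₁ , a₂
    B = a₁ + ex u , a₂ + ey u

    c c↑ : Cube
    c = a₁ , a₂ , k
    c↑ = c +ᶜ e Z

    h : Domino
    h = c , u

    A∈D : A ∈ D
    A∈D = proj₁ (base∈R th)

    B∈D : B ∈ D
    B∈D = proj₁ (proj₂ (proj₁ T c u th))

    N₀≤k : N₀ ≤ k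
    N₀≤k = proj₁ (proj₂ (base∈R th))

    k+ez≡k : k + ez u ≡ k
    k+ez≡k = trans (cong (λ w → k + w) (ez-horizontal u≢Z)) (ℤ.+-identityʳ k)

    k+1+ez≡k+1 : k + + 1 + ez u ≡ k + + 1
    k+1+ez≡k+1 = trans (cong (λ w → k + + 1 + w) (ez-horizontal u≢Z)) (ℤ.+-identityʳ _)

    k+1-2<k : k + + 1 - + 2 < k
    k+1-2<k = subst (_< k) (sym (i+1-2≡i-1 k)) (i-1<i k)

    A+0≡A : _≡_ {A = Sq} (a₁ + + 0 , a₂ + + 0) A
    A+0≡A = cong₂ _,_ (ℤ.+-identityʳ a₁) (ℤ.+-identityʳ a₂)

    A+0+0≡A : _≡_ {A = Sq} (a₁ + + 0 + + 0 , a₂ + + 0 + + 0) A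
    A+0+0≡A = cong₂ _,_ (i+0+0≡i a₁) (i+0+0≡i a₂)

    A+0+u≡B : _≡_ {A = Sq} (a₁ + + 0 + ex u , a₂ + + 0 + ey u) B
    A+0+u≡B = cong₂ _,_ (cong (_+ ex u) (ℤ.+-identityʳ a₁)) (cong (_+ ey u) (ℤ.+-identityʳ a₂))

    h-unprocessed : ¬ Processed k L h
    h-unprocessed = ∉⇒¬Processed u A∉L

    FA : F A ≡ k
    FA = gap-height h th h-unprocessed (inj₁ refl) gap A∈D

    FB : F B ≡ k
    FB = gap-height h th h-unprocessed (inj₂ (cube-≡ refl refl (sym k+ez≡k))) gap B∈D

    F' : Sq → ℤ
    F' = update (update F A (k + + 1)) B (k + + 1)

    F'A : F' A ≡ k + + 1
    F'A = trans (update-other _ B _ A (neighbour-≢ a₁ a₂ u≢Z)) (update-same F A _)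

    F'B : F' B ≡ k + + 1
    F'B = update-same _ B _

    F'-other : ∀ s → s ≢ A → s ≢ B → F' s ≡ F s
    F'-other s s≢A s≢B = trans (update-other _ B _ s s≢B) (update-other F A _ s s≢A)

    S S₁ S₂ S' : DSet
    S = Sweep k L F
    S₁ = exchange S (c , Z) (c +ᶜ e u , Z) (c , u) (c↑ , u)
    S₂ = exchange S₁ (c↑ , u) (c↑ +ᶜ e Z , u) (c↑ , Z) (c↑ +ᶜ e u , Z)
    S' = Sweep k (A ∷ L) F'

    -- h lies on the gap dominoes of columns A and B, and its raised copy is at height k + 2.  The
    -- first flip turns the two gap dominoes into h and a copy of h at height k + 1; the second
    -- turns that copy and the raised copy into the gap dominoes of A and B at height k + 1.
    h∉S : ¬ S h
    h∉S (inj₁ (_ , p)) = h-unprocessed p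
    h∉S (inj₂ (inj₁ (_ , ¬p))) = ¬p (inj₁ (i-2<i k))
    h∉S (inj₂ (inj₂ (u≡Z , _))) = u≢Z u≡Z

    h↑∉S : ¬ S (c↑ , u)
    h↑∉S (inj₁ (_ , p)) = >⇒¬Processed _ _ _ u (i<i+1 k) p
    h↑∉S (inj₂ (inj₁ (_ , ¬p))) = ¬p (inj₁ k+1-2<k)
    h↑∉S (inj₂ (inj₂ (u≡Z , _))) = u≢Z u≡Z

    flip-gap : Flip S S₁
    flip-gap = flip-exchange S c Z u (λ Z≡u → u≢Z (sym Z≡u)) (inj₂ (inj₂ (refl , A∈D , sym FA)))
                 (inj₂ (inj₂ (refl , B∈D , trans k+ez≡k (sym FB)))) h∉S h↑∉S

    raised-h-unprocessed : ¬ Processed k L ((a₁ + + 0 + + 0 , a₂ + + 0 + + 0 , k + + 1 + + 1 - + 2) , u)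
    raised-h-unprocessed (inj₁ lt) = i≮i (subst (_< k) (i+1+1-2≡i k) lt)
    raised-h-unprocessed (inj₂ (_ , A∈L)) = A∉L (subst (_∈ L) A+0+0≡A A∈L)

    vᴬ↑∉S : ¬ S (c↑ , Z)
    vᴬ↑∉S (inj₁ (_ , p)) = >⇒¬Processed _ _ _ Z (i<i+1 k) p
    vᴬ↑∉S (inj₂ (inj₁ (_ , ¬p))) = ¬p (inj₁ k+1-2<k)
    vᴬ↑∉S (inj₂ (inj₂ (_ , _ , eq))) = i≢i+1 k (sym (trans eq (trans (cong F A+0≡A) FA)))

    vᴮ↑∉S : ¬ S (c↑ +ᶜ e u , Z)
    vᴮ↑∉S (inj₁ (_ , p)) = >⇒¬Processed _ _ _ Z (subst (k <_) (sym k+1+ez≡k+1) (i<i+1 k)) p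
    vᴮ↑∉S (inj₂ (inj₁ (_ , ¬p))) = ¬p (inj₁ (subst (λ w → w - + 2 < k) (sym k+1+ez≡k+1) k+1-2<k))
    vᴮ↑∉S (inj₂ (inj₂ (_ , _ , eq))) =
      i≢i+1 k (sym (trans (sym k+1+ez≡k+1) (trans eq (trans (cong F A+0+u≡B) FB))))

    vertical∉S₁ : ∀ {c'} → ¬ S (c' , Z) → ¬ S₁ (c' , Z)
    vertical∉S₁ ∉S (inj₁ (∈S , _ , _)) = ∉S ∈S
    vertical∉S₁ ∉S (inj₂ (inj₁ eq)) = u≢Z (sym (cong proj₂ eq))
    vertical∉S₁ ∉S (inj₂ (inj₂ eq)) = u≢Z (sym (cong proj₂ eq))

    flip-raised : Flip S₁ S₂
    flip-raised = flip-exchange S₁ c↑ u Z u≢Z (inj₂ (inj₂ refl))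
      (inj₁ (inj₂ (inj₁ (subst t (sym (domino-≡ (i+0+0≡i a₁) (i+0+0≡i a₂) (i+1+1-2≡i k) refl)) th ,
                         raised-h-unprocessed)) ,
             (λ eq → u≢Z (cong proj₂ eq)) , (λ eq → u≢Z (cong proj₂ eq))))
      (vertical∉S₁ vᴬ↑∉S) (vertical∉S₁ vᴮ↑∉S)

    old-gap∈S' : ∀ x y z d → d ≡ Z → (x , y) ∈ D → z ≡ F (x , y) →
                 ((x , y , z) , d) ≢ (c , Z) → ((x , y , z) , d) ≢ (c +ᶜ e u , Z) →
                 Dec ((x , y) ≡ A) → Dec ((x , y) ≡ B) → S' ((x , y , z) , d)
    old-gap∈S' x y z d d≡Z _ z≡F ≢vᴬ _ (yes xy≡A) _ =
      ⊥-elim (≢vᴬ (domino-≡ (cong proj₁ xy≡A) (cong proj₂ xy≡A) (trans z≡F (trans (cong F xy≡A) FA)) d≡Z))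
    old-gap∈S' x y z d d≡Z _ z≡F _ ≢vᴮ (no _) (yes xy≡B) =
      ⊥-elim (≢vᴮ (domino-≡ (cong proj₁ xy≡B) (cong proj₂ xy≡B)
                            (trans z≡F (trans (cong F xy≡B) (trans FB (sym k+ez≡k)))) d≡Z))
    old-gap∈S' x y z d d≡Z xy∈D z≡F _ _ (no xy≢A) (no xy≢B) =
      inj₂ (inj₂ (d≡Z , xy∈D , trans z≡F (sym (F'-other (x , y) xy≢A xy≢B))))

    S₂⊆S' : ∀ x y z d → S₂ ((x , y , z) , d) → S' ((x , y , z) , d)
    S₂⊆S' x y z d (inj₂ (inj₁ refl)) =
      inj₂ (inj₂ (refl , subst (_∈ D) (sym A+0≡A) A∈D , sym (trans (cong F' A+0≡A) F'A)))
    S₂⊆S' x y z d (inj₂ (inj₂ refl)) =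
      inj₂ (inj₂ (refl , subst (_∈ D) (sym A+0+u≡B) B∈D , trans k+1+ez≡k+1 (sym (trans (cong F' A+0+u≡B) F'B))))
    S₂⊆S' x y z d (inj₁ (inj₂ (inj₁ refl) , _ , _)) = inj₁ (th , inj₂ (refl , here refl))
    S₂⊆S' x y z d (inj₁ (inj₂ (inj₂ refl) , ≢h↑ , _)) = ⊥-elim (≢h↑ refl)
    S₂⊆S' x y z d (inj₁ (inj₁ (inj₁ (tδ , p) , _ , _) , _ , _)) = inj₁ (tδ , Processed-∷ ((x , y , z) , d) p)
    S₂⊆S' x y z d (inj₁ (inj₁ (inj₂ (inj₁ (tδ , ¬p)) , _ , _) , _ , ≢h↑↑)) = inj₂ (inj₁ (tδ , ¬p'))
      where
      ¬p' : ¬ Processed k (A ∷ L) ((x , y , z - + 2) , d)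
      ¬p' (inj₁ lt) = ¬p (inj₁ lt)
      ¬p' (inj₂ (z-2≡k , there m)) = ¬p (inj₂ (z-2≡k , m))
      ¬p' (inj₂ (z-2≡k , here xy≡A)) =
        ≢h↑↑ (domino-≡ (trans (cong proj₁ xy≡A) (sym (i+0+0≡i a₁))) (trans (cong proj₂ xy≡A) (sym (i+0+0≡i a₂)))
                       (trans (sym (i-2+1+1≡i z)) (cong (λ w → w + + 1 + + 1) z-2≡k))
                       (cong proj₂ (same-base⇒≡ tδ th (cube-≡ (cong proj₁ xy≡A) (cong proj₂ xy≡A) z-2≡k))))
    S₂⊆S' x y z d (inj₁ (inj₁ (inj₂ (inj₂ (d≡Z , xy∈D , z≡F)) , ≢vᴬ , ≢vᴮ) , _ , _)) =
      old-gap∈S' x y z d d≡Z xy∈D z≡F ≢vᴬ ≢vᴮ ((x , y) ≟ˢ A) ((x , y) ≟ˢ B)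

    t-domino≢vᴬ : ∀ {δ} → t δ → δ ≢ (c , Z)
    t-domino≢vᴬ tδ eq = u≢Z (trans (cong proj₂ (same-base⇒≡ th tδ (sym (cong proj₁ eq)))) (cong proj₂ eq))

    t-domino≢vᴮ : ∀ {δ} → t δ → δ ≢ (c +ᶜ e u , Z)
    t-domino≢vᴮ tδ eq =
      u≢Z (trans (cong proj₂ (covers-unique th tδ (inj₂ refl) (inj₁ (sym (cong proj₁ eq))))) (cong proj₂ eq))

    k≢k+1+1 : k ≢ k + + 1 + + 1
    k≢k+1+1 = ℤ.<⇒≢ (subst (k <_) (sym (i+1+1≡i+2 k)) (i<i+2 k))

    h∈S₂ : S₂ h
    h∈S₂ = inj₁ (inj₂ (inj₁ refl) , height-≢ (i≢i+1 k) , height-≢ k≢k+1+1)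

    new-gap∈S₂ : ∀ x y z d → d ≡ Z → (x , y) ∈ D → z ≡ F' (x , y) →
                 Dec ((x , y) ≡ A) → Dec ((x , y) ≡ B) → S₂ ((x , y , z) , d)
    new-gap∈S₂ x y z d d≡Z _ z≡F' (yes xy≡A) _ =
      inj₂ (inj₁ (domino-≡ (trans (cong proj₁ xy≡A) (sym (ℤ.+-identityʳ a₁)))
                           (trans (cong proj₂ xy≡A) (sym (ℤ.+-identityʳ a₂)))
                           (trans z≡F' (trans (cong F' xy≡A) F'A)) d≡Z))
    new-gap∈S₂ x y z d d≡Z _ z≡F' (no _) (yes xy≡B) =
      inj₂ (inj₂ (domino-≡ (trans (cong proj₁ xy≡B) (sym (cong proj₁ A+0+u≡B)))
                           (trans (cong proj₂ xy≡B) (sym (cong proj₂ A+0+u≡B)))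
                           (trans z≡F' (trans (cong F' xy≡B) (trans F'B (sym k+1+ez≡k+1)))) d≡Z))
    new-gap∈S₂ x y z d d≡Z xy∈D z≡F' (no xy≢A) (no xy≢B) =
      inj₁ (inj₁ (inj₂ (inj₂ (d≡Z , xy∈D , trans z≡F' (F'-other _ xy≢A xy≢B))) ,
                  (λ eq → xy≢A (column eq)) , (λ eq → xy≢B (column eq))) ,
            (λ eq → u≢Z (trans (sym (direction eq)) d≡Z)) , (λ eq → u≢Z (trans (sym (direction eq)) d≡Z)))
      where
      column : ∀ {x' y' z' d'} → ((x , y , z) , d) ≡ ((x' , y' , z') , d') → (x , y) ≡ (x' , y')
      column eq = cong₂ _,_ (proj₁ (domino-injective eq)) (proj₁ (proj₂ (domino-injective eq)))
      direction : ∀ {c' d'} → ((x , y , z) , d) ≡ (c' , d') → d ≡ d'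
      direction = cong proj₂

    S'⊆S₂ : ∀ x y z d → S' ((x , y , z) , d) → S₂ ((x , y , z) , d)
    S'⊆S₂ x y z d (inj₁ (tδ , inj₁ z<k)) =
      inj₁ (inj₁ (inj₁ (tδ , inj₁ z<k) , height-≢ (ℤ.<⇒≢ z<k) ,
                  height-≢ (ℤ.<⇒≢ (subst (z <_) (sym k+ez≡k) z<k))) ,
            height-≢ (ℤ.<⇒≢ z<k+1) , height-≢ (ℤ.<⇒≢ (ℤ.<-trans z<k+1 (i<i+1 (k + + 1)))))
      where
      z<k+1 : z < k + + 1
      z<k+1 = ℤ.<-trans z<k (i<i+1 k)
    S'⊆S₂ x y z d (inj₁ (tδ , inj₂ (z≡k , there m))) =
      inj₁ (inj₁ (inj₁ (tδ , inj₂ (z≡k , m)) , t-domino≢vᴬ tδ , t-domino≢vᴮ tδ) ,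
            height-≢ (λ z≡ → i≢i+1 k (trans (sym z≡k) z≡)) , height-≢ (λ z≡ → k≢k+1+1 (trans (sym z≡k) z≡)))
    S'⊆S₂ x y z d (inj₁ (tδ , inj₂ (z≡k , here xy≡A))) =
      subst S₂ (sym (same-base⇒≡ tδ th (cube-≡ (cong proj₁ xy≡A) (cong proj₂ xy≡A) z≡k))) h∈S₂
    S'⊆S₂ x y z d (inj₂ (inj₁ (tδ , ¬p))) =
      inj₁ (inj₁ (inj₂ (inj₁ (tδ , λ p → ¬p (Processed-∷ ((x , y , z - + 2) , d) p))) , ≢vᴬ , ≢vᴮ) , ≢h↑ , ≢h↑↑)
      where
      height : ∀ {c' d'} → ((x , y , z) , d) ≡ ((c' , d')) → z ≡ proj₂ (proj₂ c')
      height eq = cong (λ δ → proj₂ (proj₂ (proj₁ δ))) eq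
      ≢vᴬ : ((x , y , z) , d) ≢ (c , Z)
      ≢vᴬ eq = ¬p (inj₁ (subst (λ w → w - + 2 < k) (sym (height eq)) (i-2<i k)))
      ≢vᴮ : ((x , y , z) , d) ≢ (c +ᶜ e u , Z)
      ≢vᴮ eq = ¬p (inj₁ (subst (λ w → w - + 2 < k) (sym (trans (height eq) k+ez≡k)) (i-2<i k)))
      ≢h↑ : ((x , y , z) , d) ≢ (c↑ , u)
      ≢h↑ eq = ¬p (inj₁ (subst (λ w → w - + 2 < k) (sym (height eq)) k+1-2<k))
      ≢h↑↑ : ((x , y , z) , d) ≢ (c↑ +ᶜ e Z , u)
      ≢h↑↑ eq with domino-injective eq
      ... | x≡ , y≡ , z≡ , _ =
        ¬p (inj₂ (trans (cong (_- + 2) z≡) (i+1+1-2≡i k) ,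
                  here (cong₂ _,_ (trans x≡ (i+0+0≡i a₁)) (trans y≡ (i+0+0≡i a₂)))))
    S'⊆S₂ x y z d (inj₂ (inj₂ (d≡Z , xy∈D , z≡F'))) =
      new-gap∈S₂ x y z d d≡Z xy∈D z≡F' ((x , y) ≟ˢ A) ((x , y) ≟ˢ B)

    S₂≐S' : S₂ ≐ S'
    S₂≐S' ((x , y , z) , d) = mk⇔ (S₂⊆S' x y z d) (S'⊆S₂ x y z d)

    sweep-past : S ≈ S'
    sweep-past = ≈-trans (Flip⇒≈ flip-gap) (≈-trans (Flip⇒≈ flip-raised) (≐⇒≈ S₂≐S'))

    N₀≤k+1 : N₀ ≤ k + + 1
    N₀≤k+1 = ℤ.≤-trans N₀≤k (ℤ.<⇒≤ (i<i+1 k))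

    ¬hole₀ : ∀ {s} → ¬ (s ∈ p₀ × k + + 1 ≡ N₀)
    ¬hole₀ (_ , k+1≡N₀) = ℤ.≤⇒≯ N₀≤k (subst (k <_) k+1≡N₀ (i<i+1 k))

    gap'-B : GapAt k (A ∷ L) B (F' B)
    gap'-B = subst (GapAt k (A ∷ L) B) (sym F'B)
      (inj₂ (inj₂ (h , th , inj₂ (refl , here refl) , inj₂ (cube-≡ refl refl (trans (i+1-1≡i k) (sym k+ez≡k))))) ,
       Above-intro _ _ (k + + 1) B∈D N₀≤k+1 ¬hole₀
         (unprocessed-over-horizontal h th u≢Z (inj₂ (cube-≡ refl refl (sym k+ez≡k)))))

    gap'-A : GapAt k (A ∷ L) A (F' A)
    gap'-A = subst (GapAt k (A ∷ L) A) (sym F'A)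
      (inj₂ (inj₂ (h , th , inj₂ (refl , here refl) , inj₁ (cube-≡ refl refl (i+1-1≡i k)))) ,
       Above-intro _ _ (k + + 1) A∈D N₀≤k+1 ¬hole₀ (unprocessed-over-horizontal h th u≢Z (inj₁ refl)))

    gap' : Gap k (A ∷ L) F'
    gap' s s∈D = by-column (s ≟ˢ B) (s ≟ˢ A)
      where
      ¬covers : s ≢ A → s ≢ B → ¬ Covers h (proj₁ s , proj₂ s , F s)
      ¬covers s≢A _ (inj₁ eq) = s≢A (cong₂ _,_ (proj₁ (cube-injective eq)) (proj₁ (proj₂ (cube-injective eq))))
      ¬covers _ s≢B (inj₂ eq) = s≢B (cong₂ _,_ (proj₁ (cube-injective eq)) (proj₁ (proj₂ (cube-injective eq))))
      by-column : Dec (s ≡ B) → Dec (s ≡ A) → GapAt k (A ∷ L) s (F' s)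
      by-column (yes s≡B) _ = subst (λ s → GapAt k (A ∷ L) s (F' s)) (sym s≡B) gap'-B
      by-column (no _) (yes s≡A) = subst (λ s → GapAt k (A ∷ L) s (F' s)) (sym s≡A) gap'-A
      by-column (no s≢B) (no s≢A) = subst (GapAt k (A ∷ L) s) (sym (F'-other s s≢A s≢B))
        (GapAt-∷ h th refl (¬covers s≢A s≢B) (gap s s∈D))

  module VerticalMove (a₁ a₂ k : ℤ) (L : List Sq) (F : Sq → ℤ) (tv : t ((a₁ , a₂ , k) , Z))
                      (A∉L : ¬ (a₁ , a₂) ∈ L) (gap : Gap k L F) where
    A : Sq
    A = a₁ , a₂

    c : Cube
    c = a₁ , a₂ , k

    v : Domino
    v = c , Z

    A∈D : A ∈ D
    A∈D = proj₁ (base∈R tv)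

    N₀≤k : N₀ ≤ k
    N₀≤k = proj₁ (proj₂ (base∈R tv))

    FA : F A ≡ k
    FA = gap-height v tv (∉⇒¬Processed Z A∉L) (inj₁ refl) gap A∈D

    F' : Sq → ℤ
    F' = update F A (k + + 2)

    F'A : F' A ≡ k + + 2
    F'A = update-same F A _

    F'-other : ∀ s → s ≢ A → F' s ≡ F s
    F'-other s s≢A = update-other F A _ s s≢A

    S S' : DSet
    S = Sweep k L F
    S' = Sweep k (A ∷ L) F'

    -- The gap domino of column A is v itself, and the raised copy of v becomes the new gap domino.
    raised∈S' : ∀ x y z d → t ((x , y , z - + 2) , d) → ¬ Processed k L ((x , y , z - + 2) , d) →
                Dec ((x , y , z - + 2) ≡ c) → S' ((x , y , z) , d)
    raised∈S' x y z d tδ ¬p (yes base≡c) =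
      inj₂ (inj₂ (cong proj₂ (same-base⇒≡ tδ tv base≡c) , subst (_∈ D) (sym xy≡A) A∈D ,
        trans (trans (sym (i-2+2≡i z)) (cong (_+ + 2) (proj₂ (proj₂ (cube-injective base≡c)))))
              (sym (trans (cong F' xy≡A) F'A))))
      where
      xy≡A : (x , y) ≡ A
      xy≡A = cong₂ _,_ (proj₁ (cube-injective base≡c)) (proj₁ (proj₂ (cube-injective base≡c)))
    raised∈S' x y z d tδ ¬p (no base≢c) = inj₂ (inj₁ (tδ , ¬p'))
      where
      ¬p' : ¬ Processed k (A ∷ L) ((x , y , z - + 2) , d)
      ¬p' (inj₁ lt) = ¬p (inj₁ lt)
      ¬p' (inj₂ (z-2≡k , there m)) = ¬p (inj₂ (z-2≡k , m))
      ¬p' (inj₂ (z-2≡k , here xy≡A)) = base≢c (cube-≡ (cong proj₁ xy≡A) (cong proj₂ xy≡A) z-2≡k)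

    old-gap∈S' : ∀ x y z d → d ≡ Z → (x , y) ∈ D → z ≡ F (x , y) → Dec ((x , y) ≡ A) → S' ((x , y , z) , d)
    old-gap∈S' x y z d d≡Z _ z≡F (yes xy≡A) =
      inj₁ (subst t (sym (domino-≡ (cong proj₁ xy≡A) (cong proj₂ xy≡A) z≡k d≡Z)) tv , inj₂ (z≡k , here xy≡A))
      where
      z≡k : z ≡ k
      z≡k = trans z≡F (trans (cong F xy≡A) FA)
    old-gap∈S' x y z d d≡Z xy∈D z≡F (no xy≢A) = inj₂ (inj₂ (d≡Z , xy∈D , trans z≡F (sym (F'-other _ xy≢A))))

    S⊆S' : ∀ x y z d → S ((x , y , z) , d) → S' ((x , y , z) , d)
    S⊆S' x y z d (inj₁ (tδ , p)) = inj₁ (tδ , Processed-∷ ((x , y , z) , d) p)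
    S⊆S' x y z d (inj₂ (inj₁ (tδ , ¬p))) = raised∈S' x y z d tδ ¬p ((x , y , z - + 2) ≟ᶜ c)
    S⊆S' x y z d (inj₂ (inj₂ (d≡Z , xy∈D , z≡F))) = old-gap∈S' x y z d d≡Z xy∈D z≡F ((x , y) ≟ˢ A)

    new-gap∈S : ∀ x y z d → d ≡ Z → (x , y) ∈ D → z ≡ F' (x , y) → Dec ((x , y) ≡ A) → S ((x , y , z) , d)
    new-gap∈S x y z d d≡Z _ z≡F' (yes xy≡A) = inj₂ (inj₁ (subst t (sym lowered≡v) tv , ¬p))
      where
      z-2≡k : z - + 2 ≡ k
      z-2≡k = trans (cong (_- + 2) (trans z≡F' (trans (cong F' xy≡A) F'A))) (i+2-2≡i k)
      lowered≡v : ((x , y , z - + 2) , d) ≡ v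
      lowered≡v = domino-≡ (cong proj₁ xy≡A) (cong proj₂ xy≡A) z-2≡k d≡Z
      ¬p : ¬ Processed k L ((x , y , z - + 2) , d)
      ¬p = subst (λ δ → ¬ Processed k L δ) (sym lowered≡v) (∉⇒¬Processed Z A∉L)
    new-gap∈S x y z d d≡Z xy∈D z≡F' (no xy≢A) = inj₂ (inj₂ (d≡Z , xy∈D , trans z≡F' (F'-other _ xy≢A)))

    S'⊆S : ∀ x y z d → S' ((x , y , z) , d) → S ((x , y , z) , d)
    S'⊆S x y z d (inj₁ (tδ , inj₁ z<k)) = inj₁ (tδ , inj₁ z<k)
    S'⊆S x y z d (inj₁ (tδ , inj₂ (z≡k , there m))) = inj₁ (tδ , inj₂ (z≡k , m))
    S'⊆S x y z d (inj₁ (tδ , inj₂ (z≡k , here xy≡A))) =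
      inj₂ (inj₂ (cong proj₂ (same-base⇒≡ tδ tv (cube-≡ (cong proj₁ xy≡A) (cong proj₂ xy≡A) z≡k)) ,
                  proj₁ (base∈R tδ) , trans z≡k (sym (trans (cong F xy≡A) FA))))
    S'⊆S x y z d (inj₂ (inj₁ (tδ , ¬p))) = inj₂ (inj₁ (tδ , λ p → ¬p (Processed-∷ ((x , y , z - + 2) , d) p)))
    S'⊆S x y z d (inj₂ (inj₂ (d≡Z , xy∈D , z≡F'))) = new-gap∈S x y z d d≡Z xy∈D z≡F' ((x , y) ≟ˢ A)

    S≐S' : S ≐ S'
    S≐S' ((x , y , z) , d) = mk⇔ (S⊆S' x y z d) (S'⊆S x y z d)

    N₀≤k+2 : N₀ ≤ k + + 2
    N₀≤k+2 = ℤ.≤-trans N₀≤k (ℤ.<⇒≤ (i<i+2 k))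

    ¬hole₀ : ∀ {s} → ¬ (s ∈ p₀ × k + + 2 ≡ N₀)
    ¬hole₀ (_ , k+2≡N₀) = ℤ.≤⇒≯ N₀≤k (subst (k <_) k+2≡N₀ (i<i+2 k))

    gap'-A : GapAt k (A ∷ L) A (F' A)
    gap'-A = subst (GapAt k (A ∷ L) A) (sym F'A)
      (inj₂ (inj₂ (v , tv , inj₂ (refl , here refl) ,
                   inj₂ (cube-≡ (sym (ℤ.+-identityʳ a₁)) (sym (ℤ.+-identityʳ a₂)) (i+2-1≡i+1 k)))) ,
       Above-intro a₁ a₂ (k + + 2) A∈D N₀≤k+2 ¬hole₀ unprocessed-two-above)

    gap' : Gap k (A ∷ L) F'
    gap' s s∈D = by-column (s ≟ˢ A)
      where
      ¬covers : s ≢ A → ¬ Covers v (proj₁ s , proj₂ s , F s)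
      ¬covers s≢A (inj₁ eq) = s≢A (cong₂ _,_ (proj₁ (cube-injective eq)) (proj₁ (proj₂ (cube-injective eq))))
      ¬covers s≢A (inj₂ eq) = s≢A (cong₂ _,_ (trans (proj₁ (cube-injective eq)) (ℤ.+-identityʳ a₁))
                                             (trans (proj₁ (proj₂ (cube-injective eq))) (ℤ.+-identityʳ a₂)))
      by-column : Dec (s ≡ A) → GapAt k (A ∷ L) s (F' s)
      by-column (yes s≡A) = subst (λ s → GapAt k (A ∷ L) s (F' s)) (sym s≡A) gap'-A
      by-column (no s≢A) = subst (GapAt k (A ∷ L) s) (sym (F'-other s s≢A))
        (GapAt-∷ v tv refl (¬covers s≢A) (gap s s∈D))

  SweepsTo : ℤ → List Sq → (Sq → ℤ) → ℤ → List Sq → Set₁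
  SweepsTo k L F k' L' = Σ (Sq → ℤ) λ F' → Sweep k L F ≈ Sweep k' L' F' × Gap k' L' F'

  ColumnStep : ℤ → List Sq → (Sq → ℤ) → Sq → Set₁
  ColumnStep k L F s = SweepsTo k L F k (s ∷ L)

  skip-column : ∀ {k L F s} → (∀ δ → t δ → Processed k (s ∷ L) δ → Processed k L δ) →
                Gap k L F → ColumnStep k L F s
  skip-column {F = F} nothing-new gap = F , ≐⇒≈ (Sweep-cong F agree) , Gap-cong F agree gap
    where
    agree = λ δ tδ → mk⇔ (Processed-∷ δ) (nothing-new δ tδ)

  listed⇒nothing-new : ∀ {k L s} → s ∈ L → ∀ δ → Processed k (s ∷ L) δ → Processed k L δ
  listed⇒nothing-new s∈L _ (inj₁ z<k) = inj₁ z<k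
  listed⇒nothing-new s∈L _ (inj₂ (z≡k , here refl)) = inj₂ (z≡k , s∈L)
  listed⇒nothing-new s∈L _ (inj₂ (z≡k , there m)) = inj₂ (z≡k , m)

  no-base⇒nothing-new : ∀ {k L a₁ a₂} → (∀ δ → t δ → proj₁ δ ≢ (a₁ , a₂ , k)) →
                        ∀ δ → t δ → Processed k ((a₁ , a₂) ∷ L) δ → Processed k L δ
  no-base⇒nothing-new no-base _ tδ (inj₁ z<k) = inj₁ z<k
  no-base⇒nothing-new no-base _ tδ (inj₂ (z≡k , here xy≡)) =
    ⊥-elim (no-base _ tδ (cube-≡ (cong proj₁ xy≡) (cong proj₂ xy≡) z≡k))
  no-base⇒nothing-new no-base _ tδ (inj₂ (z≡k , there m)) = inj₂ (z≡k , m)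

  horizontal-step : ∀ {k L F a₁ a₂ u} → u ≢ Z → t ((a₁ , a₂ , k) , u) → ¬ (a₁ , a₂) ∈ L → Gap k L F →
                    ColumnStep k L F (a₁ , a₂)
  horizontal-step {k} {L} {F} {a₁} {a₂} {u} u≢Z th A∉L gap = F' , sweep-past , gap'
    where open HorizontalMove a₁ a₂ k u u≢Z L F th A∉L gap

  vertical-step : ∀ {k L F a₁ a₂} → t ((a₁ , a₂ , k) , Z) → ¬ (a₁ , a₂) ∈ L → Gap k L F →
                  ColumnStep k L F (a₁ , a₂)
  vertical-step {k} {L} {F} {a₁} {a₂} tv A∉L gap = F' , ≐⇒≈ S≐S' , gap'
    where open VerticalMove a₁ a₂ k L F tv A∉L gap

  domino-step : ∀ {k L F a₁ a₂} d → t ((a₁ , a₂ , k) , d) → ¬ (a₁ , a₂) ∈ L → Gap k L F →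
                ColumnStep k L F (a₁ , a₂)
  domino-step X = horizontal-step (λ ())
  domino-step Y = horizontal-step (λ ())
  domino-step Z = vertical-step

  column-step : ∀ k L F s → Gap k L F → ColumnStep k L F s
  column-step k L F (a₁ , a₂) gap with (a₁ , a₂) ∈? L
  ... | yes s∈L = skip-column (λ δ _ → listed⇒nothing-new s∈L δ) gap
  ... | no s∉L with R? (a₁ , a₂ , k)
  ...   | no c∉R = skip-column (no-base⇒nothing-new λ δ tδ base≡c → c∉R (subst R base≡c (base∈R tδ))) gap
  ...   | yes c∈R with proj₂ T (a₁ , a₂ , k) c∈R
  ...     | (c₀ , d₀) , tδ₀ , _ , covers-c with c₀ ≟ᶜ (a₁ , a₂ , k)
  ...       | yes refl = domino-step d₀ tδ₀ s∉L gap
  ...       | no c₀≢c = skip-column (no-base⇒nothing-new no-base) gap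
    where
    no-base : ∀ δ → t δ → proj₁ δ ≢ (a₁ , a₂ , k)
    no-base δ tδ base≡c = c₀≢c (trans (sym (cong proj₁ (covers-c δ tδ (inj₁ (sym base≡c))))) base≡c)

  columns-step : ∀ k (M L : List Sq) F → Gap k L F →
                 Σ (List Sq) λ L' → M ⊆ L' × L ⊆ L' × SweepsTo k L F k L'
  columns-step k [] L F gap = L , (λ ()) , (λ m → m) , F , ≐⇒≈ ≐-refl , gap
  columns-step k (s ∷ M) L F gap with column-step k L F s gap
  ... | F₁ , sweep₁ , gap₁ with columns-step k M (s ∷ L) F₁ gap₁
  ...   | L' , M⊆L' , s∷L⊆L' , F' , sweep' , gap' =
          L' , (λ { (here refl) → s∷L⊆L' (here refl) ; (there m) → M⊆L' m }) , (λ m → s∷L⊆L' (there m)) ,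
          F' , ≈-trans sweep₁ sweep' , gap'

  next-level : ∀ {k L} → D ⊆ L → ProcessedAgree k L (k + + 1) []
  next-level {k} D⊆L δ tδ = mk⇔ to-next from-next
    where
    to-next : Processed k _ δ → Processed (k + + 1) [] δ
    to-next (inj₁ z<k) = inj₁ (ℤ.<-trans z<k (i<i+1 k))
    to-next (inj₂ (z≡k , _)) = inj₁ (subst (_< k + + 1) (sym z≡k) (i<i+1 k))
    from-next : Processed (k + + 1) [] δ → Processed k _ δ
    from-next (inj₁ z<k+1) with i<j+1⇒i<j⊎i≡j z<k+1
    ... | inj₁ z<k = inj₁ z<k
    ... | inj₂ z≡k = inj₂ (z≡k , D⊆L (proj₁ (base∈R tδ)))

  levels-step : (n : ℕ) → ∀ k F → k + + n ≡ N₁ → Gap k [] F → SweepsTo k [] F N₁ []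
  levels-step zero k F k+0≡N₁ gap rewrite sym (trans (sym (ℤ.+-identityʳ k)) k+0≡N₁) =
    F , ≐⇒≈ ≐-refl , gap
  levels-step (suc n) k F k+n+1≡N₁ gap with columns-step k D [] F gap
  ... | L , D⊆L , _ , F₁ , sweep₁ , gap₁
    with levels-step n (k + + 1) F₁ (trans (ℤ.+-assoc k (+ 1) (+ n)) k+n+1≡N₁)
                     (Gap-cong F₁ (next-level D⊆L) gap₁)
  ...   | F₂ , sweep₂ , gap₂ =
          F₂ , ≈-trans sweep₁ (≈-trans (≐⇒≈ (Sweep-cong F₁ (next-level D⊆L))) sweep₂) , gap₂

  sweep-to-top : ∀ k F → k ≤ N₁ → Gap k [] F → SweepsTo k [] F N₁ []
  sweep-to-top k F k≤N₁ = levels-step ∣ N₁ - k ∣ k F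
    (trans (cong (λ w → k + w) (ℤ.0≤i⇒+∣i∣≡i (ℤ.i≤j⇒0≤j-i k≤N₁))) (i+[j-i]≡j k N₁))

  t̃₀ t̃₁ : DSet
  t̃₀ = shiftZ (+ 2) (concat (vert D p₀ (N₀ - + 2)) t p₀ N₀)
  t̃₁ = concat t (vert D p₁ N₁) p₁ N₁

  gap₀ : Sq → ℤ
  gap₀ s with s ∈? p₀
  ... | yes _ = N₀ + + 1
  ... | no _ = N₀

  gap₀-∈ : ∀ {s} → s ∈ p₀ → gap₀ s ≡ N₀ + + 1
  gap₀-∈ {s} s∈p₀ with s ∈? p₀
  ... | yes _ = refl
  ... | no s∉p₀ = ⊥-elim (s∉p₀ s∈p₀)

  gap₀-∉ : ∀ {s} → ¬ s ∈ p₀ → gap₀ s ≡ N₀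
  gap₀-∉ {s} s∉p₀ with s ∈? p₀
  ... | yes s∈p₀ = ⊥-elim (s∉p₀ s∈p₀)
  ... | no _ = refl

  nothing-processed : ∀ δ → t δ → ¬ Processed N₀ [] δ
  nothing-processed _ tδ (inj₁ z<N₀) = ℤ.≤⇒≯ (proj₁ (proj₂ (base∈R tδ))) z<N₀
  nothing-processed _ tδ (inj₂ (_ , ()))

  everything-processed : ∀ δ → t δ → Processed N₁ [] δ
  everything-processed _ tδ = inj₁ (proj₁ (proj₂ (proj₂ (base∈R tδ))))

  initial-gap∈t̃₀ : ∀ x y z d → d ≡ Z → (x , y) ∈ D → z ≡ gap₀ (x , y) → Dec ((x , y) ∈ p₀) →
                   t̃₀ ((x , y , z) , d)
  initial-gap∈t̃₀ x y z d d≡Z _ z≡gap₀ (yes s∈p₀) =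
    inj₂ (inj₂ (s∈p₀ , trans (cong (_- + 2) (trans z≡gap₀ (gap₀-∈ s∈p₀))) (i+1-2≡i-1 N₀) , d≡Z))
  initial-gap∈t̃₀ x y z d d≡Z s∈D z≡gap₀ (no s∉p₀) =
    inj₁ (s∈D , s∉p₀ , cong (_- + 2) (trans z≡gap₀ (gap₀-∉ s∉p₀)) , d≡Z)

  t̃₀≐sweep₀ : t̃₀ ≐ Sweep N₀ [] gap₀
  t̃₀≐sweep₀ ((x , y , z) , d) = mk⇔ t̃₀⊆sweep₀ sweep₀⊆t̃₀
    where
    t̃₀⊆sweep₀ : t̃₀ ((x , y , z) , d) → Sweep N₀ [] gap₀ ((x , y , z) , d)
    t̃₀⊆sweep₀ (inj₁ (s∈D , s∉p₀ , z-2≡N₀-2 , d≡Z)) =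
      inj₂ (inj₂ (d≡Z , s∈D , trans (trans (sym (i-2+2≡i z)) (trans (cong (_+ + 2) z-2≡N₀-2) (i-2+2≡i N₀)))
                                     (sym (gap₀-∉ s∉p₀))))
    t̃₀⊆sweep₀ (inj₂ (inj₁ tδ)) = inj₂ (inj₁ (tδ , nothing-processed _ tδ))
    t̃₀⊆sweep₀ (inj₂ (inj₂ (s∈p₀ , z-2≡N₀-1 , d≡Z))) =
      inj₂ (inj₂ (d≡Z , lookup p₀⊆D s∈p₀ ,
        trans (trans (sym (i-2+2≡i z)) (trans (cong (_+ + 2) z-2≡N₀-1) (i-1+2≡i+1 N₀))) (sym (gap₀-∈ s∈p₀))))
    sweep₀⊆t̃₀ : Sweep N₀ [] gap₀ ((x , y , z) , d) → t̃₀ ((x , y , z) , d)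
    sweep₀⊆t̃₀ (inj₁ (tδ , p)) = ⊥-elim (nothing-processed _ tδ p)
    sweep₀⊆t̃₀ (inj₂ (inj₁ (tδ , _))) = inj₂ (inj₁ tδ)
    sweep₀⊆t̃₀ (inj₂ (inj₂ (d≡Z , s∈D , z≡gap₀))) = initial-gap∈t̃₀ x y z d d≡Z s∈D z≡gap₀ ((x , y) ∈? p₀)

  gap₀-valid : Gap N₀ [] gap₀
  gap₀-valid (x , y) s∈D = by-hole ((x , y) ∈? p₀)
    where
    by-hole : Dec ((x , y) ∈ p₀) → GapAt N₀ [] (x , y) (gap₀ (x , y))
    by-hole (yes s∈p₀) = subst (GapAt N₀ [] (x , y)) (sym (gap₀-∈ s∈p₀))
      (inj₂ (inj₁ (s∈p₀ , i+1-1≡i N₀)) ,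
       Above-intro x y (N₀ + + 1) s∈D (ℤ.<⇒≤ (i<i+1 N₀)) (λ (_ , N₀+1≡N₀) → i≢i+1 N₀ (sym N₀+1≡N₀))
         (λ δ tδ _ → nothing-processed δ tδ))
    by-hole (no s∉p₀) = subst (GapAt N₀ [] (x , y)) (sym (gap₀-∉ s∉p₀))
      (inj₁ (i-1<i N₀) ,
       Above-intro x y N₀ s∈D ℤ.≤-refl (λ (s∈p₀ , _) → s∉p₀ s∈p₀) (λ δ tδ _ → nothing-processed δ tδ))

  final-gap-height : ∀ F → Gap N₁ [] F → ∀ s → s ∈ D →
                     (¬ s ∈ p₁ × F s ≡ N₁) ⊎ (s ∈ p₁ × F s ≡ N₁ - + 1)
  final-gap-height F gap s s∈D with gap s s∈D
  ... | _ , inj₂ (inj₁ hole₁) = inj₂ hole₁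
  ... | _ , inj₂ (inj₂ (δ , tδ , ¬p , _)) = ⊥-elim (¬p (everything-processed δ tδ))
  ... | below , inj₁ N₁≤F = top below
    where
    top : Below N₁ [] s (F s - + 1) → (¬ s ∈ p₁ × F s ≡ N₁) ⊎ (s ∈ p₁ × F s ≡ N₁ - + 1)
    top (inj₁ F-1<N₀) = ⊥-elim (ℤ.≤⇒≯ (i<j⇒i≤j-1 (ℤ.<-≤-trans (i<i+2 N₀) (ℤ.≤-trans N₀+2≤N₁ N₁≤F))) F-1<N₀)
    top (inj₂ (inj₁ (_ , F-1≡N₀))) =
      ⊥-elim (ℤ.≤⇒≯ (subst (N₁ ≤_) (trans (sym (i-1+1≡i _)) (cong (_+ + 1) F-1≡N₀)) N₁≤F)
                    (ℤ.<-≤-trans (i+1<i+2 N₀) N₀+2≤N₁))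
    top (inj₂ (inj₂ (δ , tδ , _ , cv))) with covered⇒∈R tδ cv
    ... | _ , _ , F-1<N₁ , _ , ¬hole₁ = inj₁ ((λ s∈p₁ → ¬hole₁ (s∈p₁ , cong (_- + 1) F≡N₁)) , F≡N₁)
      where
      F≡N₁ : F s ≡ N₁
      F≡N₁ = ℤ.≤-antisym (subst (_≤ N₁) (i-1+1≡i _) (i<j⇒i+1≤j F-1<N₁)) N₁≤F

  final-sweep≐t̃₁ : ∀ F → Gap N₁ [] F → Sweep N₁ [] F ≐ t̃₁
  final-sweep≐t̃₁ F gap ((x , y , z) , d) = mk⇔ sweep⊆t̃₁ t̃₁⊆sweep
    where
    sweep⊆t̃₁ : Sweep N₁ [] F ((x , y , z) , d) → t̃₁ ((x , y , z) , d)
    sweep⊆t̃₁ (inj₁ (tδ , _)) = inj₁ tδ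
    sweep⊆t̃₁ (inj₂ (inj₁ (tδ , ¬p))) = ⊥-elim (¬p (everything-processed _ tδ))
    sweep⊆t̃₁ (inj₂ (inj₂ (d≡Z , s∈D , z≡F))) with final-gap-height F gap (x , y) s∈D
    ... | inj₁ (s∉p₁ , F≡N₁) = inj₂ (inj₁ (s∈D , s∉p₁ , trans z≡F F≡N₁ , d≡Z))
    ... | inj₂ (s∈p₁ , F≡N₁-1) = inj₂ (inj₂ (s∈p₁ , trans z≡F F≡N₁-1 , d≡Z))
    t̃₁⊆sweep : t̃₁ ((x , y , z) , d) → Sweep N₁ [] F ((x , y , z) , d)
    t̃₁⊆sweep (inj₁ tδ) = inj₁ (tδ , everything-processed _ tδ)
    t̃₁⊆sweep (inj₂ (inj₁ (s∈D , s∉p₁ , z≡N₁ , d≡Z))) with final-gap-height F gap (x , y) s∈D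
    ... | inj₁ (_ , F≡N₁) = inj₂ (inj₂ (d≡Z , s∈D , trans z≡N₁ (sym F≡N₁)))
    ... | inj₂ (s∈p₁ , _) = ⊥-elim (s∉p₁ s∈p₁)
    t̃₁⊆sweep (inj₂ (inj₂ (s∈p₁ , z≡N₁-1 , d≡Z))) with final-gap-height F gap (x , y) (lookup p₁⊆D s∈p₁)
    ... | inj₁ (s∉p₁ , _) = ⊥-elim (s∉p₁ s∈p₁)
    ... | inj₂ (_ , F≡N₁-1) = inj₂ (inj₂ (d≡Z , lookup p₁⊆D s∈p₁ , trans z≡N₁-1 (sym F≡N₁-1)))

lemma5p2 : (D : List Sq) → IsDisk D → Balanced D →
             (p₀ p₁ : List Sq) → IsPlug D p₀ → IsPlug D p₁ →
             (N₀ N₁ : ℤ) → N₀ + + 2 ≤ N₁ →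
             (t : DSet) → IsTiling (Cork D N₀ N₁ p₀ p₁) t →
             shiftZ (+ 2) (concat (vert D p₀ (N₀ - + 2)) t p₀ N₀)
               ≈ concat t (vert D p₁ N₁) p₁ N₁
lemma5p2 D _ _ p₀ p₁ (_ , p₀⊆D , _) (_ , p₁⊆D , _) N₀ N₁ N₀+2≤N₁ t T = t̃₀≈t̃₁
  where
  open Sweep D p₀ p₁ p₀⊆D p₁⊆D N₀ N₁ N₀+2≤N₁ t T
  t̃₀≈t̃₁ : t̃₀ ≈ t̃₁
  t̃₀≈t̃₁ with sweep-to-top N₀ gap₀ (ℤ.≤-trans (ℤ.i≤i+j N₀ (+ 2)) N₀+2≤N₁) gap₀-valid
  ... | F , sweep₀≈sweep₁ , gap₁ =
    ≈-trans (≐⇒≈ t̃₀≐sweep₀) (≈-trans sweep₀≈sweep₁ (≐⇒≈ (final-sweep≐t̃₁ F gap₁)))
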